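{- If $\mathcal E$ is a path object category, then its associated cloven weak factorisation system is functorially Frobenius: for every pullback square $i\bar f=f\bar\imath$ (with $\bar\imath\colon f^*X\to B$, $\bar f\colon f^*X\to X$) of a cloven $\mathcal L$-map $i\colon X\to A$ along a cloven $\mathcal R$-map $f\colon B\to A$, one may assign a cloven $\mathcal L$-map structure on $\bar\imath$, and this assignment is functorial, giving a functor $\mathcal R\text{ -Map}\times_{\mathcal E}\mathcal L\text{ -Map}\to\mathcal L\text{ -Map}$.
   Context: Path object category: finitely complete $\mathcal E$ with (Axiom 1) a pullback-preserving endofunctor $M$ and natural $s,t\colon MX\to X$, $r\colon X\to MX$, $m\colon MX\,{}_{s_X}\!\times_{t_X}MX\to MX$, $\tau$ making $(X,MX,s_X,t_X,r_X,m_X)$ an internal category with $\tau_X$ an involution giving an identity-on-objects isomorphism with its opposite; (Axiom 2) a strength $\alpha_{X,Y}\colon MX\times Y\to M(X\times Y)$ for which $s,t,r,m,\tau$ are strong; (Axiom 3) a strong natural $\eta\colon M\Rightarrow MM$ with $s_{MX}\eta_X=1$, $t_{MX}\eta_X=r_Xt_X$, $Ms_X\eta_X=1$, $Mt_X\eta_X=\alpha_{1,X}(M!,t_X)$, $\eta_Xr_X=r_{MX}r_X$. Associated cloven w.f.s.: for $f\colon X\to Y$, $Pf=X\times_{f,t_Y}MY$ with projections $e_f,d_f$, $\rho_f=s_Yd_f$, $\lambda_f=(1_X,r_Yf)$, $P(h,k)=(he_f,Mk\,d_f)$. Cloven $\mathcal L$-map structure on $f$: $s\colon Y\to Pf$ with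 $sf=\lambda_f$, $\rho_fs=1$; cloven $\mathcal R$-map structure: $p\colon Pf\to X$ with $p\lambda_f=1$, $fp=\rho_f$. $\mathcal L\text{ -Map}$, $\mathcal R\text{ -Map}$ are the categories of cloven $\mathcal L$-/$\mathcal R$-maps with morphisms the commutative squares $(h,k)$ satisfying $P(h,k)s=tk$, resp. $qP(h,k)=hp$; the fibre product is over the common corner object $A$. -}

module Defs where

open import Level using (Level; _⊔_) renaming (suc to lsuc)
open import Relation.Binary.PropositionalEquality
  using (_≡_; refl; sym; trans; cong; module ≡-Reasoning)

record Category (o ℓ : Level) : Set (lsuc (o ⊔ ℓ)) where
  infixr 9 _∘_
  field
    Obj       : Set o
    Hom       : Obj → Obj → Set ℓ
    id        : ∀ {A} → Hom A A
    _∘_       : ∀ {A B C} → Hom B C → Hom A B → Hom A C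
    identityˡ : ∀ {A B} {f : Hom A B} → id ∘ f ≡ f
    identityʳ : ∀ {A B} {f : Hom A B} → f ∘ id ≡ f
    assoc     : ∀ {A B C D} {f : Hom A B} {g : Hom B C} {h : Hom C D} →
                (h ∘ g) ∘ f ≡ h ∘ (g ∘ f)

module _ {o ℓ : Level} (C : Category o ℓ) where
  open Category C

  record IsPullback {P X Y Z : Obj} (p₁ : Hom P X) (p₂ : Hom P Y)
                    (f : Hom X Z) (g : Hom Y Z) : Set (o ⊔ ℓ) where
    field
      commute      : f ∘ p₁ ≡ g ∘ p₂
      universal    : ∀ {W} (a : Hom W X) (b : Hom W Y) → f ∘ a ≡ g ∘ b → Hom W P
      universal-p₁ : ∀ {W} {a : Hom W X} {b : Hom W Y} (e : f ∘ a ≡ g ∘ b) →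
                     p₁ ∘ universal a b e ≡ a
      universal-p₂ : ∀ {W} {a : Hom W X} {b : Hom W Y} (e : f ∘ a ≡ g ∘ b) →
                     p₂ ∘ universal a b e ≡ b
      unique       : ∀ {W} {a : Hom W X} {b : Hom W Y} (e : f ∘ a ≡ g ∘ b)
                     (v : Hom W P) → p₁ ∘ v ≡ a → p₂ ∘ v ≡ b → v ≡ universal a b e

  record Pullback {X Y Z : Obj} (f : Hom X Z) (g : Hom Y Z) : Set (o ⊔ ℓ) where
    field
      P          : Obj
      p₁         : Hom P X
      p₂         : Hom P Y
      isPullback : IsPullback p₁ p₂ f g
    open IsPullback isPullback public

  record IsTerminal (T : Obj) : Set (o ⊔ ℓ) where
    field
      !        : ∀ {A} → Hom A T
      !-unique : ∀ {A} (h : Hom A T) → h ≡ !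

record FinitelyComplete (o ℓ : Level) : Set (lsuc (o ⊔ ℓ)) where
  field
    category : Category o ℓ
  open Category category
  field
    ⊤        : Obj
    terminal : IsTerminal category ⊤
    pullback : ∀ {X Y Z} (f : Hom X Z) (g : Hom Y Z) → Pullback category f g

module FCOps {o ℓ : Level} (E : FinitelyComplete o ℓ) where
  open FinitelyComplete E
  open Category category
  open IsTerminal terminal public

  PB : ∀ {X Y Z} (f : Hom X Z) (g : Hom Y Z) → Obj
  PB f g = Pullback.P (pullback f g)

  pb₁ : ∀ {X Y Z} (f : Hom X Z) (g : Hom Y Z) → Hom (PB f g) X
  pb₁ f g = Pullback.p₁ (pullback f g)

  pb₂ : ∀ {X Y Z} (f : Hom X Z) (g : Hom Y Z) → Hom (PB f g) Y
  pb₂ f g = Pullback.p₂ (pullback f g)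

  pbpair : ∀ {X Y Z W} (f : Hom X Z) (g : Hom Y Z) (a : Hom W X) (b : Hom W Y) →
           f ∘ a ≡ g ∘ b → Hom W (PB f g)
  pbpair f g a b e = Pullback.universal (pullback f g) a b e

  infixr 7 _×_
  _×_ : Obj → Obj → Obj
  A × B = PB (! {A}) (! {B})

  π₁ : ∀ {A B} → Hom (A × B) A
  π₁ {A} {B} = pb₁ (! {A}) (! {B})

  π₂ : ∀ {A B} → Hom (A × B) B
  π₂ {A} {B} = pb₂ (! {A}) (! {B})

  !-eq : ∀ {W A B} (a : Hom W A) (b : Hom W B) → ! ∘ a ≡ ! ∘ b
  !-eq a b = trans (!-unique (! ∘ a)) (sym (!-unique (! ∘ b)))

  ⟨_,_⟩ : ∀ {W A B} → Hom W A → Hom W B → Hom W (A × B)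
  ⟨ a , b ⟩ = pbpair ! ! a b (!-eq a b)

  infixr 8 _⁂_
  _⁂_ : ∀ {A B C D} → Hom A C → Hom B D → Hom (A × B) (C × D)
  f ⁂ g = ⟨ f ∘ π₁ , g ∘ π₂ ⟩

  assocʳ : ∀ {A B C} → Hom ((A × B) × C) (A × (B × C))
  assocʳ = ⟨ π₁ ∘ π₁ , ⟨ π₂ ∘ π₁ , π₂ ⟩ ⟩

record PathObjectCategory (o ℓ : Level) : Set (lsuc (o ⊔ ℓ)) where
  field
    E : FinitelyComplete o ℓ
  open FinitelyComplete E
  open Category category
  open FCOps E
  field
    M₀     : Obj → Obj
    M₁     : ∀ {X Y} → Hom X Y → Hom (M₀ X) (M₀ Y)
    M-id   : ∀ {X} → M₁ (id {X}) ≡ id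
    M-∘    : ∀ {X Y Z} {f : Hom X Y} {g : Hom Y Z} → M₁ (g ∘ f) ≡ M₁ g ∘ M₁ f
    M-pullback : ∀ {P X Y Z} {p₁ : Hom P X} {p₂ : Hom P Y} {f : Hom X Z} {g : Hom Y Z} →
                 IsPullback category p₁ p₂ f g →
                 IsPullback category (M₁ p₁) (M₁ p₂) (M₁ f) (M₁ g)
    s      : ∀ {X} → Hom (M₀ X) X
    t      : ∀ {X} → Hom (M₀ X) X
    r      : ∀ {X} → Hom X (M₀ X)
    s-nat  : ∀ {X Y} (f : Hom X Y) → s ∘ M₁ f ≡ f ∘ s
    t-nat  : ∀ {X Y} (f : Hom X Y) → t ∘ M₁ f ≡ f ∘ t
    r-nat  : ∀ {X Y} (f : Hom X Y) → r ∘ f ≡ M₁ f ∘ r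
    m      : ∀ {X} → Hom (PB (s {X}) (t {X})) (M₀ X)
    m-nat  : ∀ {X Y} (f : Hom X Y)
             (e : s ∘ (M₁ f ∘ pb₁ s t) ≡ t ∘ (M₁ f ∘ pb₂ s t)) →
             M₁ f ∘ m {X} ≡ m ∘ pbpair s t (M₁ f ∘ pb₁ s t) (M₁ f ∘ pb₂ s t) e
    s-r    : ∀ {X} → s ∘ r {X} ≡ id
    t-r    : ∀ {X} → t ∘ r {X} ≡ id
    s-m    : ∀ {X} → s ∘ m {X} ≡ s ∘ pb₂ s t
    t-m    : ∀ {X} → t ∘ m {X} ≡ t ∘ pb₁ s t
    m-unitʳ : ∀ {X} (e : s ∘ id ≡ t ∘ (r ∘ s)) →
              m {X} ∘ pbpair s t id (r ∘ s) e ≡ id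
    m-unitˡ : ∀ {X} (e : s ∘ (r ∘ t) ≡ t ∘ id) →
              m {X} ∘ pbpair s t (r ∘ t) id e ≡ id
    m-assoc : ∀ {X W} (a b c : Hom W (M₀ X))
              (e₁ : s ∘ a ≡ t ∘ b) (e₂ : s ∘ b ≡ t ∘ c)
              (e₃ : s ∘ (m ∘ pbpair s t a b e₁) ≡ t ∘ c)
              (e₄ : s ∘ a ≡ t ∘ (m ∘ pbpair s t b c e₂)) →
              m ∘ pbpair s t (m ∘ pbpair s t a b e₁) c e₃ ≡
              m ∘ pbpair s t a (m ∘ pbpair s t b c e₂) e₄
    -- natural involution τ: identity-on-objects isomorphism with the opposite
    τ       : ∀ {X} → Hom (M₀ X) (M₀ X)
    τ-nat   : ∀ {X Y} (f : Hom X Y) → τ ∘ M₁ f ≡ M₁ f ∘ τ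
    τ-invol : ∀ {X} → τ ∘ τ {X} ≡ id
    s-τ     : ∀ {X} → s ∘ τ {X} ≡ t
    t-τ     : ∀ {X} → t ∘ τ {X} ≡ s
    τ-r     : ∀ {X} → τ ∘ r {X} ≡ r
    τ-m     : ∀ {X} (e : s ∘ (τ ∘ pb₂ s t) ≡ t ∘ (τ ∘ pb₁ s t)) →
              τ ∘ m {X} ≡ m ∘ pbpair s t (τ ∘ pb₂ s t) (τ ∘ pb₁ s t) e
    α        : ∀ {X Y} → Hom (M₀ X × Y) (M₀ (X × Y))
    α-nat    : ∀ {X X' Y Y'} (f : Hom X X') (g : Hom Y Y') →
               α ∘ (M₁ f ⁂ g) ≡ M₁ (f ⁂ g) ∘ α
    α-unit   : ∀ {X} → M₁ π₁ ∘ α {X} {⊤} ≡ π₁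
    α-assoc  : ∀ {X Y Z} →
               M₁ assocʳ ∘ (α {X × Y} {Z} ∘ (α {X} {Y} ⁂ id)) ≡ α {X} {Y × Z} ∘ assocʳ
    s-strong : ∀ {X Y} → s ∘ α {X} {Y} ≡ s ⁂ id
    t-strong : ∀ {X Y} → t ∘ α {X} {Y} ≡ t ⁂ id
    r-strong : ∀ {X Y} → α ∘ (r ⁂ id) ≡ r {X × Y}
    τ-strong : ∀ {X Y} → τ ∘ α {X} {Y} ≡ α ∘ (τ ⁂ id)
    m-strong : ∀ {X Y W} (a b : Hom W (M₀ X)) (y : Hom W Y)
               (e : s ∘ a ≡ t ∘ b)
               (e' : s ∘ (α ∘ ⟨ a , y ⟩) ≡ t ∘ (α ∘ ⟨ b , y ⟩)) →
               m ∘ pbpair s t (α ∘ ⟨ a , y ⟩) (α ∘ ⟨ b , y ⟩) e' ≡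
               α ∘ ⟨ m ∘ pbpair s t a b e , y ⟩
    η        : ∀ {X} → Hom (M₀ X) (M₀ (M₀ X))
    η-nat    : ∀ {X Y} (f : Hom X Y) → η ∘ M₁ f ≡ M₁ (M₁ f) ∘ η
    η-strong : ∀ {X Y} → η ∘ α {X} {Y} ≡ M₁ α ∘ (α ∘ (η ⁂ id))
    η-s      : ∀ {X} → s ∘ η {X} ≡ id
    η-t      : ∀ {X} → t ∘ η {X} ≡ r ∘ t
    η-Ms     : ∀ {X} → M₁ s ∘ η {X} ≡ id
    -- M t_X η_X = α_{1,X} (M!, t_X), with M(1 × X) ≅ MX via M π₂
    η-Mt     : ∀ {X} → M₁ t ∘ η {X} ≡ M₁ π₂ ∘ (α {⊤} {X} ∘ ⟨ M₁ ! , t ⟩)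
    η-r      : ∀ {X} → η ∘ r {X} ≡ r ∘ r

module PathOps {o ℓ : Level} (C : PathObjectCategory o ℓ) where
  open PathObjectCategory C public
  open FinitelyComplete E public
  open Category category public
  open FCOps E public

  Pf : ∀ {X Y} (f : Hom X Y) → Obj
  Pf f = PB f t

  e-map : ∀ {X Y} (f : Hom X Y) → Hom (Pf f) X
  e-map f = pb₁ f t

  d-map : ∀ {X Y} (f : Hom X Y) → Hom (Pf f) (M₀ Y)
  d-map f = pb₂ f t

  ρ : ∀ {X Y} (f : Hom X Y) → Hom (Pf f) Y
  ρ f = s ∘ d-map f

  lam-eq : ∀ {X Y} (f : Hom X Y) → f ∘ id ≡ t ∘ (r ∘ f)
  lam-eq f = begin
      f ∘ id        ≡⟨ identityʳ ⟩
      f             ≡⟨ sym identityˡ ⟩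
      id ∘ f        ≡⟨ cong (_∘ f) (sym t-r) ⟩
      (t ∘ r) ∘ f   ≡⟨ assoc ⟩
      t ∘ (r ∘ f)   ∎
    where open ≡-Reasoning

  lam : ∀ {X Y} (f : Hom X Y) → Hom X (Pf f)
  lam f = pbpair f t id (r ∘ f) (lam-eq f)

  P-eq : ∀ {X Y X' Y'} (f : Hom X Y) (f' : Hom X' Y') (h : Hom X X') (k : Hom Y Y') →
         f' ∘ h ≡ k ∘ f → f' ∘ (h ∘ e-map f) ≡ t ∘ (M₁ k ∘ d-map f)
  P-eq f f' h k sq = begin
      f' ∘ (h ∘ e-map f)       ≡⟨ sym assoc ⟩
      (f' ∘ h) ∘ e-map f       ≡⟨ cong (_∘ e-map f) sq ⟩
      (k ∘ f) ∘ e-map f        ≡⟨ assoc ⟩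
      k ∘ (f ∘ e-map f)        ≡⟨ cong (k ∘_) (Pullback.commute (pullback f t)) ⟩
      k ∘ (t ∘ d-map f)        ≡⟨ sym assoc ⟩
      (k ∘ t) ∘ d-map f        ≡⟨ cong (_∘ d-map f) (sym (t-nat k)) ⟩
      (t ∘ M₁ k) ∘ d-map f     ≡⟨ assoc ⟩
      t ∘ (M₁ k ∘ d-map f)     ∎
    where open ≡-Reasoning

  P[_,_] : ∀ {X Y X' Y'} {f : Hom X Y} {f' : Hom X' Y'} (h : Hom X X') (k : Hom Y Y') →
           f' ∘ h ≡ k ∘ f → Hom (Pf f) (Pf f')
  P[_,_] {f = f} {f'} h k sq = pbpair f' t (h ∘ e-map f) (M₁ k ∘ d-map f) (P-eq f f' h k sq)

  record LStr {X Y} (f : Hom X Y) : Set ℓ where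
    field
      sec   : Hom Y (Pf f)
      sec-lam : sec ∘ f ≡ lam f
      ρ-sec : ρ f ∘ sec ≡ id

  record RStr {X Y} (f : Hom X Y) : Set ℓ where
    field
      ret   : Hom (Pf f) X
      ret-lam : ret ∘ lam f ≡ id
      f-ret : f ∘ ret ≡ ρ f

  IsLMor : ∀ {X Y X' Y'} {f : Hom X Y} {f' : Hom X' Y'} →
           LStr f → LStr f' → (h : Hom X X') (k : Hom Y Y') → f' ∘ h ≡ k ∘ f → Set ℓ
  IsLMor σ σ' h k sq = P[ h , k ] sq ∘ LStr.sec σ ≡ LStr.sec σ' ∘ k

  IsRMor : ∀ {X Y X' Y'} {f : Hom X Y} {f' : Hom X' Y'} →
           RStr f → RStr f' → (h : Hom X X') (k : Hom Y Y') → f' ∘ h ≡ k ∘ f → Set ℓ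
  IsRMor π π' h k sq = RStr.ret π' ∘ P[ h , k ] sq ≡ h ∘ RStr.ret π

-- Objects of the fibre product are pairs of a
-- cloven R-map f : B → A and a cloven L-map i : X → A; morphisms are pairs
-- of an R-Map morphism (h_B , k) and an L-Map morphism (h_X , k) with the
-- same component k at the common corner A.

record FunctoriallyFrobenius {o ℓ : Level} (C : PathObjectCategory o ℓ) : Set (o ⊔ ℓ) where
  open PathOps C
  field
    frob : ∀ {A B X Q} {f : Hom B A} {i : Hom X A} → RStr f → LStr i →
           {ī : Hom Q B} {f̄ : Hom Q X} → IsPullback category ī f̄ f i →
           LStr ī
    frob-mor : ∀ {A B X Q A' B' X' Q'}
               {f : Hom B A} {i : Hom X A} {φ : RStr f} {σ : LStr i}
               {f' : Hom B' A'} {i' : Hom X' A'} {φ' : RStr f'} {σ' : LStr i'}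
               (hB : Hom B B') (hX : Hom X X') (k : Hom A A')
               (sqf : f' ∘ hB ≡ k ∘ f) (sqi : i' ∘ hX ≡ k ∘ i) →
               IsRMor φ φ' hB k sqf → IsLMor σ σ' hX k sqi →
               {ī : Hom Q B} {f̄ : Hom Q X} (pb : IsPullback category ī f̄ f i)
               {ī' : Hom Q' B'} {f̄' : Hom Q' X'} (pb' : IsPullback category ī' f̄' f' i')
               (u : Hom Q Q') (u₁ : ī' ∘ u ≡ hB ∘ ī) (u₂ : f̄' ∘ u ≡ hX ∘ f̄) →
               IsLMor (frob φ σ pb) (frob φ' σ' pb') u hB u₁

module Submission where

-- Let f : B → A carry an R-structure (a retraction p of λ_f : B → Pf) and
-- i : X → A an L-structure (a section σ of ρ_i).  The L-structure exhibits X
-- as a deformation retract of A: σ yields a retraction x_σ : A → X of i and a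
-- path δ_σ from i x_σ to the identity of A, trivial along i.  For b a point of B
-- the path δ_σ(f b) ends at f b; contracting it in the path object Pf and
-- pushing the contraction down along p lifts it to a path γ in B from b to
-- a point b' with f b' = i x_σ(f b).  The pair (b' , x_σ(f b)) is a point of
-- the pullback Q = f*X, and together with γ it is the required section of
-- ρ for ī : Q → B.  Every ingredient is natural, which gives functoriality.

open import Level using (Level)
open import Relation.Binary.PropositionalEquality
  using (_≡_; refl; sym; trans; cong; cong₂; module ≡-Reasoning)
open import Defs

module FrobeniusConstruction {o ℓ : Level} (C : PathObjectCategory o ℓ) where
  open PathOps C
  open ≡-Reasoning

  private
    variable
      V W X Y A B Q : Obj

  pullˡ : ∀ {Z} {a : Hom Y Z} {b : Hom X Y} {c : Hom X Z} {d : Hom W X} →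
          a ∘ b ≡ c → a ∘ (b ∘ d) ≡ c ∘ d
  pullˡ {d = d} eq = trans (sym assoc) (cong (_∘ d) eq)

  pb-ext : ∀ {P Z} {p₁ : Hom P X} {p₂ : Hom P Y} {f : Hom X Z} {g : Hom Y Z} →
           IsPullback category p₁ p₂ f g → {a b : Hom W P} →
           p₁ ∘ a ≡ p₁ ∘ b → p₂ ∘ a ≡ p₂ ∘ b → a ≡ b
  pb-ext {p₁ = p₁} {p₂} {f} {g} pb {a} {b} e₁ e₂ =
    trans (unique commutes a e₁ e₂) (sym (unique commutes b refl refl))
    where
      open IsPullback pb
      commutes : f ∘ (p₁ ∘ b) ≡ g ∘ (p₂ ∘ b)
      commutes = trans (pullˡ commute) assoc

  chosen-isPullback : ∀ {Z} (f : Hom X Z) (g : Hom Y Z) →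
                      IsPullback category (pb₁ f g) (pb₂ f g) f g
  chosen-isPullback f g = Pullback.isPullback (pullback f g)

  pbpair-p₁ : ∀ {Z} {f : Hom X Z} {g : Hom Y Z} {a : Hom W X} {b : Hom W Y}
              (e : f ∘ a ≡ g ∘ b) → pb₁ f g ∘ pbpair f g a b e ≡ a
  pbpair-p₁ {f = f} {g} e = Pullback.universal-p₁ (pullback f g) e

  pbpair-p₂ : ∀ {Z} {f : Hom X Z} {g : Hom Y Z} {a : Hom W X} {b : Hom W Y}
              (e : f ∘ a ≡ g ∘ b) → pb₂ f g ∘ pbpair f g a b e ≡ b
  pbpair-p₂ {f = f} {g} e = Pullback.universal-p₂ (pullback f g) e

  pbpair-∘ : ∀ {Z} {f : Hom X Z} {g : Hom Y Z} {a : Hom W X} {b : Hom W Y}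
             {e : f ∘ a ≡ g ∘ b} {h : Hom V W} {a' : Hom V X} {b' : Hom V Y}
             {e' : f ∘ a' ≡ g ∘ b'} →
             a ∘ h ≡ a' → b ∘ h ≡ b' → pbpair f g a b e ∘ h ≡ pbpair f g a' b' e'
  pbpair-∘ {f = f} {g} {e = e} {e' = e'} ea eb = pb-ext (chosen-isPullback f g)
    (trans (pullˡ (pbpair-p₁ e)) (trans ea (sym (pbpair-p₁ e'))))
    (trans (pullˡ (pbpair-p₂ e)) (trans eb (sym (pbpair-p₂ e'))))

  π₂-⟨⟩ : {a : Hom W X} {b : Hom W Y} → π₂ ∘ ⟨ a , b ⟩ ≡ b
  π₂-⟨⟩ {a = a} {b} = pbpair-p₂ (!-eq a b)

  ⁂-⟨⟩ : ∀ {X' Y'} {f : Hom X X'} {g : Hom Y Y'} {a : Hom W X} {b : Hom W Y} →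
         (f ⁂ g) ∘ ⟨ a , b ⟩ ≡ ⟨ f ∘ a , g ∘ b ⟩
  ⁂-⟨⟩ {f = f} {g} {a} {b} =
    pbpair-∘ (trans assoc (cong (f ∘_) (pbpair-p₁ (!-eq a b))))
             (trans assoc (cong (g ∘_) π₂-⟨⟩))

  s-slide : {g : Hom X Y} {v : Hom W (M₀ X)} → g ∘ (s ∘ v) ≡ s ∘ (M₁ g ∘ v)
  s-slide {g = g} = trans (pullˡ (sym (s-nat g))) assoc

  t-slide : {g : Hom X Y} {v : Hom W (M₀ X)} → g ∘ (t ∘ v) ≡ t ∘ (M₁ g ∘ v)
  t-slide {g = g} = trans (pullˡ (sym (t-nat g))) assoc

  M-r : {g : Hom X Y} {v : Hom W X} → M₁ g ∘ (r ∘ v) ≡ r ∘ (g ∘ v)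
  M-r {g = g} = trans (pullˡ (sym (r-nat g))) assoc

  M-square : ∀ {Z Z'} {a : Hom Y Z} {b : Hom X Y} {c : Hom Z' Z} {d : Hom X Z'}
             {v : Hom W (M₀ X)} → a ∘ b ≡ c ∘ d → M₁ a ∘ (M₁ b ∘ v) ≡ M₁ c ∘ (M₁ d ∘ v)
  M-square sq =
    trans (pullˡ (trans (sym M-∘) (trans (cong M₁ sq) M-∘))) assoc

  -- The constant path at a point y, with "shape" a : W → M⊤ carried along
  -- by the strength; these are the paths of B over which the contraction
  -- of a path δ in A moves the B-coordinate.
  const : Hom W (M₀ ⊤) → Hom W Y → Hom W (M₀ Y)
  const a y = M₁ π₂ ∘ (α ∘ ⟨ a , y ⟩)

  endpoint-const : (ε : ∀ {Z} → Hom (M₀ Z) Z) →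
                   (∀ {Z Z'} (g : Hom Z Z') → ε ∘ M₁ g ≡ g ∘ ε) →
                   (∀ {Z Z'} → ε ∘ α {Z} {Z'} ≡ ε ⁂ id) →
                   {a : Hom W (M₀ ⊤)} {y : Hom W Y} → ε ∘ const a y ≡ y
  endpoint-const ε ε-nat ε-strong {a = a} {y} = begin
    ε ∘ (M₁ π₂ ∘ (α ∘ ⟨ a , y ⟩))  ≡⟨ pullˡ (ε-nat π₂) ⟩
    (π₂ ∘ ε) ∘ (α ∘ ⟨ a , y ⟩)      ≡⟨ trans assoc (cong (π₂ ∘_) (pullˡ ε-strong)) ⟩
    π₂ ∘ ((ε ⁂ id) ∘ ⟨ a , y ⟩)     ≡⟨ cong (π₂ ∘_) ⁂-⟨⟩ ⟩
    π₂ ∘ ⟨ ε ∘ a , id ∘ y ⟩         ≡⟨ trans π₂-⟨⟩ identityˡ ⟩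
    y                               ∎

  s-const : {a : Hom W (M₀ ⊤)} {y : Hom W Y} → s ∘ const a y ≡ y
  s-const = endpoint-const s s-nat s-strong

  t-const : {a : Hom W (M₀ ⊤)} {y : Hom W Y} → t ∘ const a y ≡ y
  t-const = endpoint-const t t-nat t-strong

  const-∘ : {a : Hom W (M₀ ⊤)} {y : Hom W Y} {g : Hom V W} →
            const a y ∘ g ≡ const (a ∘ g) (y ∘ g)
  const-∘ = trans assoc (cong (M₁ π₂ ∘_) (trans assoc (cong (α ∘_) (pbpair-∘ refl refl))))

  M-const : {a : Hom W (M₀ ⊤)} {y : Hom W X} {h : Hom X Y} →
            M₁ h ∘ const a y ≡ const a (h ∘ y)
  M-const {a = a} {y} {h} = begin
    M₁ h ∘ (M₁ π₂ ∘ (α ∘ ⟨ a , y ⟩))              ≡⟨ M-square (sym π₂-⟨⟩) ⟩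
    M₁ π₂ ∘ (M₁ (id ⁂ h) ∘ (α ∘ ⟨ a , y ⟩))       ≡⟨ cong (M₁ π₂ ∘_) (pullˡ (sym (α-nat id h))) ⟩
    M₁ π₂ ∘ ((α ∘ (M₁ id ⁂ h)) ∘ ⟨ a , y ⟩)       ≡⟨ cong (M₁ π₂ ∘_) (trans assoc (cong (α ∘_) ⁂-⟨⟩)) ⟩
    M₁ π₂ ∘ (α ∘ ⟨ M₁ id ∘ a , h ∘ y ⟩)           ≡⟨ cong (λ z → M₁ π₂ ∘ (α ∘ ⟨ z , h ∘ y ⟩))
                                                          (trans (cong (_∘ a) M-id) identityˡ) ⟩
    M₁ π₂ ∘ (α ∘ ⟨ a , h ∘ y ⟩)                   ∎

  const-r : {a : Hom W ⊤} {y : Hom W Y} → const (r ∘ a) y ≡ r ∘ y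
  const-r {a = a} {y} = begin
    M₁ π₂ ∘ (α ∘ ⟨ r ∘ a , y ⟩)            ≡⟨ cong (λ z → M₁ π₂ ∘ (α ∘ z))
                                                 (trans (cong (λ z → ⟨ r ∘ a , z ⟩) (sym identityˡ)) (sym ⁂-⟨⟩)) ⟩
    M₁ π₂ ∘ (α ∘ ((r ⁂ id) ∘ ⟨ a , y ⟩))  ≡⟨ cong (M₁ π₂ ∘_) (pullˡ r-strong) ⟩
    M₁ π₂ ∘ (r ∘ ⟨ a , y ⟩)               ≡⟨ trans M-r (cong (r ∘_) π₂-⟨⟩) ⟩
    r ∘ y                                  ∎

  Mt-η : {δ : Hom W (M₀ A)} → M₁ t ∘ (η ∘ δ) ≡ const (M₁ ! ∘ δ) (t ∘ δ)
  Mt-η = trans (pullˡ η-Mt) const-∘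

  trivial-end : {f : Hom X Y} {b : Hom W X} {δ : Hom W (M₀ Y)} →
                δ ≡ r ∘ (f ∘ b) → f ∘ b ≡ t ∘ δ
  trivial-end eδ = trans (sym identityˡ) (trans (sym (pullˡ t-r)) (cong (t ∘_) (sym eδ)))

  pair-trivial : {f : Hom X Y} {b : Hom W X} {δ : Hom W (M₀ Y)} {e : f ∘ b ≡ t ∘ δ} →
                 δ ≡ r ∘ (f ∘ b) → pbpair f t b δ e ≡ lam f ∘ b
  pair-trivial eδ = sym (pbpair-∘ identityˡ (trans assoc (sym eδ)))

  P-pair : ∀ {X' Y'} {f : Hom X Y} {f' : Hom X' Y'} {h : Hom X X'} {k : Hom Y Y'}
           (sq : f' ∘ h ≡ k ∘ f) {b : Hom W X} {δ : Hom W (M₀ Y)} {e : f ∘ b ≡ t ∘ δ}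
           {b' : Hom W X'} {δ' : Hom W (M₀ Y')} {e' : f' ∘ b' ≡ t ∘ δ'} →
           h ∘ b ≡ b' → M₁ k ∘ δ ≡ δ' → P[ h , k ] sq ∘ pbpair f t b δ e ≡ pbpair f' t b' δ' e'
  P-pair {h = h} {k} sq {e = e} hb kδ =
    pbpair-∘ (trans assoc (trans (cong (h ∘_) (pbpair-p₁ e)) hb))
             (trans assoc (trans (cong (M₁ k ∘_) (pbpair-p₂ e)) kδ))

  MP-isPullback : (f : Hom X Y) →
                  IsPullback category (M₁ (e-map f)) (M₁ (d-map f)) (M₁ f) (M₁ t)
  MP-isPullback f = M-pullback (chosen-isPullback f t)

  contract-eq : (f : Hom B A) (b : Hom W B) (δ : Hom W (M₀ A)) → f ∘ b ≡ t ∘ δ →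
                M₁ f ∘ const (M₁ ! ∘ δ) b ≡ M₁ t ∘ (η ∘ δ)
  contract-eq f b δ e = trans M-const (trans (cong (const (M₁ ! ∘ δ)) e) (sym Mt-η))

  -- The contraction of a point (b , δ) of Pf: the path in Pf whose
  -- B-component is constant at b and whose path component is η δ,
  -- running from (b , δ) to λ_f b.
  contract : (f : Hom B A) (b : Hom W B) (δ : Hom W (M₀ A)) → f ∘ b ≡ t ∘ δ →
             Hom W (M₀ (Pf f))
  contract f b δ e =
    IsPullback.universal (MP-isPullback f) (const (M₁ ! ∘ δ) b) (η ∘ δ) (contract-eq f b δ e)

  module _ {f : Hom B A} {b : Hom W B} {δ : Hom W (M₀ A)} {e : f ∘ b ≡ t ∘ δ} where
    contract-e : M₁ (e-map f) ∘ contract f b δ e ≡ const (M₁ ! ∘ δ) b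
    contract-e = IsPullback.universal-p₁ (MP-isPullback f) (contract-eq f b δ e)

    contract-d : M₁ (d-map f) ∘ contract f b δ e ≡ η ∘ δ
    contract-d = IsPullback.universal-p₂ (MP-isPullback f) (contract-eq f b δ e)

  module _ {f : Hom B A} {b : Hom W B} {δ : Hom W (M₀ A)} {e : f ∘ b ≡ t ∘ δ} where

    s-contract : s ∘ contract f b δ e ≡ pbpair f t b δ e
    s-contract = pb-ext (chosen-isPullback f t)
      (trans s-slide (trans (cong (s ∘_) contract-e) (trans s-const (sym (pbpair-p₁ e)))))
      (trans s-slide (trans (cong (s ∘_) contract-d)
             (trans (trans (pullˡ η-s) identityˡ) (sym (pbpair-p₂ e)))))

    t-contract : t ∘ contract f b δ e ≡ lam f ∘ b
    t-contract = trans (pb-ext (chosen-isPullback f t)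
      (trans t-slide (trans (cong (t ∘_) contract-e) (trans t-const (sym (pbpair-p₁ trivial)))))
      (trans t-slide (trans (cong (t ∘_) contract-d)
             (trans (trans (pullˡ η-t) (trans assoc (cong (r ∘_) (sym e)))) (sym (pbpair-p₂ trivial))))))
      (pair-trivial refl)
      where
        trivial : f ∘ b ≡ t ∘ (r ∘ (f ∘ b))
        trivial = trivial-end refl

    contract-∘ : {g : Hom V W} {b' : Hom V B} {δ' : Hom V (M₀ A)} {e' : f ∘ b' ≡ t ∘ δ'} →
                 b ∘ g ≡ b' → δ ∘ g ≡ δ' → contract f b δ e ∘ g ≡ contract f b' δ' e'
    contract-∘ bg δg = pb-ext (MP-isPullback f)
      (trans (pullˡ contract-e) (trans const-∘
             (trans (cong₂ const (trans assoc (cong (M₁ ! ∘_) δg)) bg) (sym contract-e))))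
      (trans (pullˡ contract-d) (trans assoc (trans (cong (η ∘_) δg) (sym contract-d))))

    contract-trivial : δ ≡ r ∘ (f ∘ b) → contract f b δ e ≡ r ∘ pbpair f t b δ e
    contract-trivial eδ = pb-ext (MP-isPullback f)
      (begin
        M₁ (e-map f) ∘ contract f b δ e        ≡⟨ contract-e ⟩
        const (M₁ ! ∘ δ) b                     ≡⟨ cong (λ z → const z b) (trans (cong (M₁ ! ∘_) eδ) M-r) ⟩
        const (r ∘ (! ∘ (f ∘ b))) b            ≡⟨ const-r ⟩
        r ∘ b                                  ≡⟨ sym (trans M-r (cong (r ∘_) (pbpair-p₁ e))) ⟩
        M₁ (e-map f) ∘ (r ∘ pbpair f t b δ e)  ∎)
      (begin
        M₁ (d-map f) ∘ contract f b δ e        ≡⟨ contract-d ⟩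
        η ∘ δ                                  ≡⟨ cong (η ∘_) eδ ⟩
        η ∘ (r ∘ (f ∘ b))                      ≡⟨ trans (pullˡ η-r) assoc ⟩
        r ∘ (r ∘ (f ∘ b))                      ≡⟨ cong (r ∘_) (sym eδ) ⟩
        r ∘ δ                                  ≡⟨ sym (trans M-r (cong (r ∘_) (pbpair-p₂ e))) ⟩
        M₁ (d-map f) ∘ (r ∘ pbpair f t b δ e)  ∎)

  M-contract : ∀ {B' A'} {f : Hom B A} {f' : Hom B' A'} {h : Hom B B'} {k : Hom A A'}
               (sq : f' ∘ h ≡ k ∘ f) {b : Hom W B} {δ : Hom W (M₀ A)} {e : f ∘ b ≡ t ∘ δ}
               {b' : Hom W B'} {δ' : Hom W (M₀ A')} {e' : f' ∘ b' ≡ t ∘ δ'} →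
               h ∘ b ≡ b' → M₁ k ∘ δ ≡ δ' →
               M₁ (P[ h , k ] sq) ∘ contract f b δ e ≡ contract f' b' δ' e'
  M-contract {f = f} {f'} {h} {k} sq {b} {δ} {e} {b'} {δ'} {e'} hb kδ = pb-ext (MP-isPullback f')
    (begin
      M₁ (e-map f') ∘ (M₁ P ∘ contract f b δ e)  ≡⟨ M-square (pbpair-p₁ (P-eq f f' h k sq)) ⟩
      M₁ h ∘ (M₁ (e-map f) ∘ contract f b δ e)  ≡⟨ cong (M₁ h ∘_) contract-e ⟩
      M₁ h ∘ const (M₁ ! ∘ δ) b                 ≡⟨ trans M-const (cong₂ const shape hb) ⟩
      const (M₁ ! ∘ δ') b'                      ≡⟨ sym contract-e ⟩
      M₁ (e-map f') ∘ contract f' b' δ' e'      ∎)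
    (begin
      M₁ (d-map f') ∘ (M₁ P ∘ contract f b δ e)  ≡⟨ M-square (pbpair-p₂ (P-eq f f' h k sq)) ⟩
      M₁ (M₁ k) ∘ (M₁ (d-map f) ∘ contract f b δ e) ≡⟨ cong (M₁ (M₁ k) ∘_) contract-d ⟩
      M₁ (M₁ k) ∘ (η ∘ δ)                       ≡⟨ trans (pullˡ (sym (η-nat k))) assoc ⟩
      η ∘ (M₁ k ∘ δ)                            ≡⟨ cong (η ∘_) kδ ⟩
      η ∘ δ'                                    ≡⟨ sym contract-d ⟩
      M₁ (d-map f') ∘ contract f' b' δ' e'      ∎)
    where
      P = P[ h , k ] sq
      shape : M₁ ! ∘ δ ≡ M₁ ! ∘ δ'
      shape = trans (cong (_∘ δ) (trans (cong M₁ (sym (!-unique (! ∘ k)))) M-∘))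
                    (trans assoc (cong (M₁ ! ∘_) kδ))

  -- Path lifting along an R-map f with retraction p : Pf → B: a path δ in A
  -- ending at f b lifts to the path  τ (M p (contract b δ))  in B, which
  -- runs from b to p (b , δ).
  lift : {f : Hom B A} → RStr f → (b : Hom W B) (δ : Hom W (M₀ A)) → f ∘ b ≡ t ∘ δ →
         Hom W (M₀ B)
  lift {f = f} φ b δ e = τ ∘ (M₁ (RStr.ret φ) ∘ contract f b δ e)

  module _ {f : Hom B A} (φ : RStr f) where
    open RStr φ renaming (ret to p)

    ret-trivial : {b : Hom W B} {δ : Hom W (M₀ A)} {e : f ∘ b ≡ t ∘ δ} →
                  δ ≡ r ∘ (f ∘ b) → p ∘ pbpair f t b δ e ≡ b
    ret-trivial eδ = trans (cong (p ∘_) (pair-trivial eδ)) (trans (pullˡ ret-lam) identityˡ)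

    module _ {b : Hom W B} {δ : Hom W (M₀ A)} {e : f ∘ b ≡ t ∘ δ} where
      s-lift : s ∘ lift φ b δ e ≡ b
      s-lift = trans (pullˡ s-τ) (trans (sym t-slide)
                 (trans (cong (p ∘_) t-contract) (trans (pullˡ ret-lam) identityˡ)))

      t-lift : t ∘ lift φ b δ e ≡ p ∘ pbpair f t b δ e
      t-lift = trans (pullˡ t-τ) (trans (sym s-slide) (cong (p ∘_) s-contract))

      lift-∘ : {g : Hom V W} {b' : Hom V B} {δ' : Hom V (M₀ A)} {e' : f ∘ b' ≡ t ∘ δ'} →
               b ∘ g ≡ b' → δ ∘ g ≡ δ' → lift φ b δ e ∘ g ≡ lift φ b' δ' e'
      lift-∘ bg δg = trans assoc (cong (τ ∘_) (trans assoc (cong (M₁ p ∘_) (contract-∘ bg δg))))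

      lift-trivial : δ ≡ r ∘ (f ∘ b) → lift φ b δ e ≡ r ∘ b
      lift-trivial eδ = begin
        τ ∘ (M₁ p ∘ contract f b δ e)          ≡⟨ cong (λ z → τ ∘ (M₁ p ∘ z)) (contract-trivial eδ) ⟩
        τ ∘ (M₁ p ∘ (r ∘ pbpair f t b δ e))    ≡⟨ cong (τ ∘_) (trans M-r (cong (r ∘_) (ret-trivial eδ))) ⟩
        τ ∘ (r ∘ b)                            ≡⟨ pullˡ τ-r ⟩
        r ∘ b                                  ∎

  M-lift : ∀ {B' A'} {f : Hom B A} {f' : Hom B' A'} {φ : RStr f} {φ' : RStr f'}
           {h : Hom B B'} {k : Hom A A'} {sq : f' ∘ h ≡ k ∘ f} → IsRMor φ φ' h k sq →
           {b : Hom W B} {δ : Hom W (M₀ A)} {e : f ∘ b ≡ t ∘ δ}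
           {b' : Hom W B'} {δ' : Hom W (M₀ A')} {e' : f' ∘ b' ≡ t ∘ δ'} →
           h ∘ b ≡ b' → M₁ k ∘ δ ≡ δ' → M₁ h ∘ lift φ b δ e ≡ lift φ' b' δ' e'
  M-lift {f = f} {φ = φ} {φ'} {h} {k} {sq} φm {b} {δ} {e} {b'} {δ'} {e'} hb kδ = begin
    M₁ h ∘ (τ ∘ (M₁ p ∘ contract f b δ e))          ≡⟨ trans (pullˡ (sym (τ-nat h))) assoc ⟩
    τ ∘ (M₁ h ∘ (M₁ p ∘ contract f b δ e))          ≡⟨ cong (τ ∘_) (M-square (sym φm)) ⟩
    τ ∘ (M₁ p' ∘ (M₁ (P[ h , k ] sq) ∘ contract f b δ e)) ≡⟨ cong (λ z → τ ∘ (M₁ p' ∘ z)) (M-contract sq hb kδ) ⟩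
    lift φ' b' δ' e'                                ∎
    where
      p = RStr.ret φ
      p' = RStr.ret φ'

  -- An L-structure σ on i : X → A exhibits X as a deformation retract of A:
  -- a retraction x_σ = e_i σ of i and a path δ_σ = τ d_i σ from i x_σ to the
  -- identity of A, trivial along i.
  module _ {i : Hom X A} (σ : LStr i) where
    open LStr σ

    retraction : Hom A X
    retraction = e-map i ∘ sec

    deformation : Hom A (M₀ A)
    deformation = τ ∘ (d-map i ∘ sec)

    t-deformation : t ∘ deformation ≡ id
    t-deformation = trans (pullˡ t-τ) (trans (sym assoc) ρ-sec)

    s-deformation : s ∘ deformation ≡ i ∘ retraction
    s-deformation =
      trans (pullˡ s-τ) (trans (pullˡ (sym (Pullback.commute (pullback i t)))) assoc)

    retraction-i : retraction ∘ i ≡ id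
    retraction-i = trans assoc (trans (cong (e-map i ∘_) sec-lam) (pbpair-p₁ (lam-eq i)))

    deformation-i : deformation ∘ i ≡ r ∘ i
    deformation-i = trans assoc (trans (cong (τ ∘_)
      (trans assoc (trans (cong (d-map i ∘_) sec-lam) (pbpair-p₂ (lam-eq i))))) (pullˡ τ-r))

  module _ {X' A'} {i : Hom X A} {i' : Hom X' A'} {σ : LStr i} {σ' : LStr i'}
           {h : Hom X X'} {k : Hom A A'} {sq : i' ∘ h ≡ k ∘ i} (σm : IsLMor σ σ' h k sq) where
    retraction-nat : retraction σ' ∘ k ≡ h ∘ retraction σ
    retraction-nat = trans assoc (trans (cong (e-map i' ∘_) (sym σm))
                       (trans (pullˡ (pbpair-p₁ (P-eq i i' h k sq))) assoc))

    deformation-nat : deformation σ' ∘ k ≡ M₁ k ∘ deformation σ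
    deformation-nat = trans assoc (trans (cong (τ ∘_) (trans assoc (trans (cong (d-map i' ∘_) (sym σm))
                        (trans (pullˡ (pbpair-p₂ (P-eq i i' h k sq))) assoc))))
                        (trans (pullˡ (τ-nat k)) assoc))

  -- For a point b of B, the deformation path
  -- δ b = δ_σ (f b) runs from i x to f b, where x = x_σ (f b); its lift γ b
  -- runs from b to a point b' with f b' = i x, so q b = (b' , x) lies in Q,
  -- and (q b , γ b) is a point of P ī over b: a section of ρ_ī.
  module Frobenius {f : Hom B A} {i : Hom X A} (φ : RStr f) (σ : LStr i)
                   {ī : Hom Q B} {f̄ : Hom Q X} (pb : IsPullback category ī f̄ f i) where
    open RStr φ renaming (ret to p)
    module Q = IsPullback pb

    δ : Hom B (M₀ A)
    δ = deformation σ ∘ f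

    δ-ends : f ∘ id ≡ t ∘ δ
    δ-ends = trans identityʳ (sym (trans (pullˡ (t-deformation σ)) identityˡ))

    γ : Hom B (M₀ B)
    γ = lift φ id δ δ-ends

    x : Hom B X
    x = retraction σ ∘ f

    γ-end-over : f ∘ (t ∘ γ) ≡ i ∘ x
    γ-end-over = begin
      f ∘ (t ∘ γ)                           ≡⟨ cong (f ∘_) (t-lift φ) ⟩
      f ∘ (p ∘ pbpair f t id δ δ-ends)      ≡⟨ trans (pullˡ f-ret) assoc ⟩
      s ∘ (d-map f ∘ pbpair f t id δ δ-ends) ≡⟨ cong (s ∘_) (pbpair-p₂ δ-ends) ⟩
      s ∘ δ                                 ≡⟨ trans (pullˡ (s-deformation σ)) assoc ⟩
      i ∘ x                                 ∎

    q : Hom B Q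
    q = Q.universal (t ∘ γ) x γ-end-over

    q-start : ī ∘ q ≡ t ∘ γ
    q-start = Q.universal-p₁ γ-end-over

    section : Hom B (Pf ī)
    section = pbpair ī t q γ q-start

    ρ-section : ρ ī ∘ section ≡ id
    ρ-section = trans assoc (trans (cong (s ∘_) (pbpair-p₂ q-start)) (s-lift φ))

    -- Along ī the deformation path is trivial, hence so is its lift.
    δ-ī : δ ∘ ī ≡ r ∘ (f ∘ ī)
    δ-ī = trans assoc (trans (cong (deformation σ ∘_) Q.commute)
            (trans (pullˡ (deformation-i σ)) (trans assoc (cong (r ∘_) (sym Q.commute)))))

    γ-ī : γ ∘ ī ≡ r ∘ ī
    γ-ī = trans (lift-∘ φ {e' = trivial-end δ-ī} identityˡ refl) (lift-trivial φ δ-ī)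

    q-ī : q ∘ ī ≡ id
    q-ī = pb-ext pb
      (trans (pullˡ q-start) (trans assoc (trans (cong (t ∘_) γ-ī)
             (trans (pullˡ t-r) (trans identityˡ (sym identityʳ))))))
      (trans (pullˡ (Q.universal-p₂ γ-end-over)) (trans assoc (trans (cong (retraction σ ∘_) Q.commute)
             (trans (pullˡ (retraction-i σ)) (trans identityˡ (sym identityʳ))))))

    section-λ : section ∘ ī ≡ lam ī
    section-λ = pbpair-∘ q-ī γ-ī

    structure : LStr ī
    structure = record { sec = section ; sec-lam = section-λ ; ρ-sec = ρ-section }

  frob : ∀ {A B X Q} {f : Hom B A} {i : Hom X A} → RStr f → LStr i →
         {ī : Hom Q B} {f̄ : Hom Q X} → IsPullback category ī f̄ f i → LStr ī
  frob φ σ pb = Frobenius.structure φ σ pb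

  -- Every step of the construction is natural: the
  -- deformation path by deformation-nat, its lift by M-lift, and q by the
  -- universal property of Q'.
  frob-mor : ∀ {A B X Q A' B' X' Q'}
             {f : Hom B A} {i : Hom X A} {φ : RStr f} {σ : LStr i}
             {f' : Hom B' A'} {i' : Hom X' A'} {φ' : RStr f'} {σ' : LStr i'}
             (hB : Hom B B') (hX : Hom X X') (k : Hom A A')
             (sqf : f' ∘ hB ≡ k ∘ f) (sqi : i' ∘ hX ≡ k ∘ i) →
             IsRMor φ φ' hB k sqf → IsLMor σ σ' hX k sqi →
             {ī : Hom Q B} {f̄ : Hom Q X} (pb : IsPullback category ī f̄ f i)
             {ī' : Hom Q' B'} {f̄' : Hom Q' X'} (pb' : IsPullback category ī' f̄' f' i')
             (u : Hom Q Q') (u₁ : ī' ∘ u ≡ hB ∘ ī) (u₂ : f̄' ∘ u ≡ hX ∘ f̄) →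
             IsLMor (frob φ σ pb) (frob φ' σ' pb') u hB u₁
  frob-mor {φ = φ} {σ} {f'} {φ' = φ'} {σ'} hB hX k sqf sqi φm σm {ī} {f̄} pb {ī'} {f̄'} pb' u u₁ u₂ =
    trans (P-pair u₁ {e' = section'-∘-eq} q-nat γ-nat) (sym (pbpair-∘ refl refl))
    where
      module F = Frobenius φ σ pb
      module F' = Frobenius φ' σ' pb'

      δ-nat : F'.δ ∘ hB ≡ M₁ k ∘ F.δ
      δ-nat = trans assoc (trans (cong (deformation σ' ∘_) sqf)
                (trans (pullˡ (deformation-nat {σ = σ} {σ'} {sq = sqi} σm)) assoc))

      lifted-end : f' ∘ hB ≡ t ∘ (M₁ k ∘ F.δ)
      lifted-end = trans sqf (trans (cong (k ∘_) (trans (sym identityʳ) F.δ-ends)) t-slide)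

      γ-nat : M₁ hB ∘ F.γ ≡ F'.γ ∘ hB
      γ-nat = trans (M-lift {φ = φ} {φ'} {sq = sqf} φm {e' = lifted-end} identityʳ refl)
                    (sym (lift-∘ φ' identityˡ δ-nat))

      x-nat : hX ∘ F.x ≡ F'.x ∘ hB
      x-nat = trans (pullˡ (sym (retraction-nat {σ = σ} {σ'} {sq = sqi} σm)))
                (trans assoc (trans (cong (retraction σ' ∘_) (sym sqf)) (sym assoc)))

      q-nat : u ∘ F.q ≡ F'.q ∘ hB
      q-nat = pb-ext pb'
        (begin
          ī' ∘ (u ∘ F.q)     ≡⟨ trans (pullˡ u₁) assoc ⟩
          hB ∘ (ī ∘ F.q)     ≡⟨ cong (hB ∘_) F.q-start ⟩
          hB ∘ (t ∘ F.γ)     ≡⟨ t-slide ⟩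
          t ∘ (M₁ hB ∘ F.γ)  ≡⟨ cong (t ∘_) γ-nat ⟩
          t ∘ (F'.γ ∘ hB)    ≡⟨ sym (trans (pullˡ F'.q-start) assoc) ⟩
          ī' ∘ (F'.q ∘ hB)   ∎)
        (begin
          f̄' ∘ (u ∘ F.q)     ≡⟨ trans (pullˡ u₂) assoc ⟩
          hX ∘ (f̄ ∘ F.q)     ≡⟨ cong (hX ∘_) (IsPullback.universal-p₂ pb F.γ-end-over) ⟩
          hX ∘ F.x           ≡⟨ x-nat ⟩
          F'.x ∘ hB          ≡⟨ sym (pullˡ (IsPullback.universal-p₂ pb' F'.γ-end-over)) ⟩
          f̄' ∘ (F'.q ∘ hB)   ∎)

      section'-∘-eq : ī' ∘ (F'.q ∘ hB) ≡ t ∘ (F'.γ ∘ hB)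
      section'-∘-eq = trans (pullˡ F'.q-start) assoc

proposition6p11 : ∀ {o ℓ : Level} (C : PathObjectCategory o ℓ) → FunctoriallyFrobenius C
-- (The structures φ, σ, φ', σ' occur in the type of frob-mor only under
-- projections, so they cannot be inferred and are passed on by name.)
proposition6p11 C = record
  { frob     = frob
  ; frob-mor = λ {φ = φ} {σ = σ} {φ' = φ'} {σ' = σ'} → frob-mor {φ = φ} {σ} {φ' = φ'} {σ'}
  }
  where open FrobeniusConstruction C
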